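{- For every integer $k\geq 1$ there exist an integer $n>k$ and an $n\times n$-matrix $\mathrm{X}$ all of whose entries are $0$ or $1$ such that $\mathrm{X}$ satisfies the $k$-configuration exhibition condition but does not satisfy the convex Ramsey condition.
   Context: Let $\mathrm{C}=(c_{jl})$ be an $n\times m$-matrix with entries in $\{0,1\}$ and $m\geq k$. $\mathrm{C}$ satisfies the $k$-configuration exhibition condition if for every $\sigma:\{1,\dots,k\}\to\{0,1\}$ and every $1\leq l_1<\dots<l_k\leq m$ there is a row index $1\leq j\leq n$ with $c_{j l_i}=\sigma(i)$ for all $1\leq i\leq k$. An $m\times 1$-matrix $\mathrm{W}$ is a Dirac-weight matrix if exactly one entry of $\mathrm{W}$ equals $1$, exactly one entry equals $-1$, and all other entries are $0$. A $1\times n$-matrix $\mathrm{P}=(p_1\ \cdots\ p_n)$ is a probability matrix if $p_i\geq 0$ for all $i$ and $\sum_i p_i=1$. An $n\times m$ $\{0,1\}$-matrix $\mathrm{Y}$ satisfies the convex Ramsey condition if there is a $1\times n$ probability matrix $\mathrm{P}$ such that $\mathrm{P}\times\mathrm{Y}\times\mathrm{W}\leq\frac12$ for every $m\times 1$ Dirac-weight matrix $\mathrm{W}$.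
   Formalization: In the convex Ramsey condition, the probability matrix $\mathrm{P}$ has entries in ℚ. -}

module Defs where

open import Data.Nat using (ℕ; zero; suc) renaming (_≤_ to _≤ℕ_; _<_ to _<ℕ_)
open import Data.Fin using (Fin; zero; suc) renaming (_<_ to _<ᶠ_)
open import Data.Bool using (Bool; true; false)
open import Data.Rational using (ℚ; 0ℚ; 1ℚ; -_; _+_; _*_; _≤_; ½)
open import Data.Product using (Σ; ∃; _×_; _,_)
open import Relation.Binary.PropositionalEquality using (_≡_; _≢_)
open import Relation.Nullary using (¬_)

-- n × m matrices with entries in {0,1}  (true = 1, false = 0)
BinMatrix : ℕ → ℕ → Set
BinMatrix n m = Fin n → Fin m → Bool

bitℚ : Bool → ℚ
bitℚ true  = 1ℚ
bitℚ false = 0ℚ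

sumℚ : (n : ℕ) → (Fin n → ℚ) → ℚ
sumℚ zero    f = 0ℚ
sumℚ (suc n) f = f zero + sumℚ n (λ i → f (suc i))

ConfigExhibition : (k : ℕ) {n m : ℕ} → BinMatrix n m → Set
ConfigExhibition k {n} {m} C =
  (k ≤ℕ m) ×
  ((σ : Fin k → Bool) (l : Fin k → Fin m) →
     (∀ i i′ → i <ᶠ i′ → l i <ᶠ l i′) →
     ∃ λ (j : Fin n) → ∀ i → C j (l i) ≡ σ i)

-- m × 1 Dirac-weight matrix (as a column vector Fin m → ℚ)
IsDiracWeight : {m : ℕ} → (Fin m → ℚ) → Set
IsDiracWeight {m} W =
  ∃ λ (a : Fin m) → ∃ λ (b : Fin m) →
    (W a ≡ 1ℚ) × (W b ≡ - 1ℚ) ×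
    (∀ c → c ≢ a → c ≢ b → W c ≡ 0ℚ)

-- 1 × n probability matrix (as a row vector Fin n → ℚ)
IsProbability : {n : ℕ} → (Fin n → ℚ) → Set
IsProbability {n} P = (∀ i → 0ℚ ≤ P i) × (sumℚ n P ≡ 1ℚ)

-- the 1 × 1 matrix product  P × Y × W, as a scalar
tripleProduct : {n m : ℕ} → (Fin n → ℚ) → BinMatrix n m → (Fin m → ℚ) → ℚ
tripleProduct {n} {m} P Y W =
  sumℚ n (λ j → P j * sumℚ m (λ l → bitℚ (Y j l) * W l))

ConvexRamsey : {n m : ℕ} → BinMatrix n m → Set
ConvexRamsey {n} {m} Y =
  ∃ λ (P : Fin n → ℚ) → IsProbability P ×
    ((W : Fin m → ℚ) → IsDiracWeight W → tripleProduct P Y W ≤ ½)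

-- Let M = 4k + 1.  The columns of X are M pairs (aₘ, bₘ) together with the
-- N = 2^t binary words of length t.  A row is given by a table of k entries
-- (coordinate, key, bit).  Its k coordinates D restrict every word to a word
-- of length k; a word column is keyed by this restriction, a paired column by
-- itself.  The entry of the row at a column is the bit of the first table
-- entry carrying the column's key, and by default 1 at aₘ and 0 elsewhere.
--
--  * Exhibition: k distinct words are separated by k coordinates (separate),
--    so k distinct columns have distinct keys and one table prescribes any
--    k bits on them (exhibitingRow-exhibits).
--  * No convex Ramsey: k table entries lower the M pair balances aₘ - bₘ
--    (each 1 by default) by at most 2k in total (balance-bound), and
--    M - 2k > M/2 (surplus-too-big).  So for every probability vector the M
--    Dirac weights of the pairs average above 1/2 (notConvexRamsey).
--  * Size: there are (t B)^k tables, B the number of (key, bit) pairs, and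
--    they fit into the 2^t + 2M rows once t is large (polynomial≤2^).

module Submission where

open import Defs
open import Data.Bool using (Bool; true; false; if_then_else_)
open import Data.Empty using (⊥-elim)
open import Data.Fin using (Fin; zero; suc; _≟_; toℕ; fromℕ<; inject≤; splitAt; join; remQuot; combine; funToFin; finToFun)
  renaming (_<_ to _<ᶠ_)
open import Data.Fin.Properties using (splitAt-join; join-splitAt; remQuot-combine; combine-injective; funToFin-finToFin; finToFun-funToFin; toℕ-injective; toℕ-fromℕ<; toℕ-inject≤; toℕ<n; any?; ¬∀⟶∃¬)
import Data.Fin.Properties as Finₚ
open import Data.Nat as ℕ using (ℕ; zero; suc; z≤n; s≤s)
import Data.Nat.Properties as ℕ
open import Data.Product using (∃; _×_; _,_; proj₁; proj₂)
open import Data.Rational using (ℚ; 0ℚ; 1ℚ; ½; -_; _+_; _*_; _-_; _≤_; _<_; nonNegative)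
open import Data.Rational.Properties hiding (_≟_; <-cmp)
open import Data.Rational.Solver using (module +-*-Solver)
open import Data.Sum using (_⊎_; inj₁; inj₂)
import Data.Sum as Sum
open import Data.Sum.Properties using (≡-dec; inj₁-injective; inj₂-injective)
open import Data.Vec.Functional using (_∷_)
open import Function using (_∘_)
open import Relation.Binary.Definitions using (DecidableEquality; tri<; tri≈; tri>)
open import Relation.Binary.PropositionalEquality
open import Relation.Nullary using (¬_; Dec; yes; no; does; contradiction)
open import Relation.Nullary.Decidable using (_×-dec_; ¬?)

sum-cong : ∀ n {f g : Fin n → ℚ} → (∀ i → f i ≡ g i) → sumℚ n f ≡ sumℚ n g
sum-cong zero    f≗g = refl
sum-cong (suc n) f≗g = cong₂ _+_ (f≗g zero) (sum-cong n (λ i → f≗g (suc i)))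

sum-mono : ∀ n {f g : Fin n → ℚ} → (∀ i → f i ≤ g i) → sumℚ n f ≤ sumℚ n g
sum-mono zero    f≤g = ≤-refl
sum-mono (suc n) f≤g = +-mono-≤ (f≤g zero) (sum-mono n (λ i → f≤g (suc i)))

sum-zero : ∀ n → sumℚ n (λ _ → 0ℚ) ≡ 0ℚ
sum-zero zero    = refl
sum-zero (suc n) = cong (0ℚ +_) (sum-zero n)

sum-+ : ∀ n (f g : Fin n → ℚ) → sumℚ n (λ i → f i + g i) ≡ sumℚ n f + sumℚ n g
sum-+ zero    f g = refl
sum-+ (suc n) f g =
  trans (cong (f zero + g zero +_) (sum-+ n (λ i → f (suc i)) (λ i → g (suc i))))
        (interchange (f zero) (g zero) _ _)
  where
  open +-*-Solver
  interchange : ∀ a b c d → (a + b) + (c + d) ≡ (a + c) + (b + d)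
  interchange = solve 4 (λ a b c d → (a :+ b) :+ (c :+ d) := (a :+ c) :+ (b :+ d)) refl

sum-diff : ∀ n (f g : Fin n → ℚ) → sumℚ n (λ i → f i - g i) ≡ sumℚ n f - sumℚ n g
sum-diff zero    f g = refl
sum-diff (suc n) f g =
  trans (cong (f zero - g zero +_) (sum-diff n (λ i → f (suc i)) (λ i → g (suc i))))
        (interchange (f zero) (g zero) _ _)
  where
  open +-*-Solver
  interchange : ∀ a b c d → (a - b) + (c - d) ≡ (a + c) - (b + d)
  interchange = solve 4 (λ a b c d → (a :- b) :+ (c :- d) := (a :+ c) :- (b :+ d)) refl

sum-*ˡ : ∀ n (c : ℚ) (f : Fin n → ℚ) → sumℚ n (λ i → c * f i) ≡ c * sumℚ n f
sum-*ˡ zero    c f = sym (*-zeroʳ c)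
sum-*ˡ (suc n) c f =
  trans (cong (c * f zero +_) (sum-*ˡ n c (λ i → f (suc i)))) (sym (*-distribˡ-+ c _ _))

sum-swap : ∀ m n (F : Fin m → Fin n → ℚ) →
  sumℚ m (λ i → sumℚ n (F i)) ≡ sumℚ n (λ j → sumℚ m (λ i → F i j))
sum-swap zero    n F = sym (sum-zero n)
sum-swap (suc m) n F =
  trans (cong (sumℚ n (F zero) +_) (sum-swap m n (λ i → F (suc i))))
        (sym (sum-+ n (F zero) (λ j → sumℚ m (λ i → F (suc i) j))))

convex-lower : ∀ n (P f : Fin n → ℚ) (b : ℚ) → IsProbability P → (∀ i → b ≤ f i) →
  b ≤ sumℚ n (λ i → P i * f i)
convex-lower n P f b (P≥0 , ΣP≡1) b≤f = begin
  b                          ≡⟨ sym (*-identityʳ b) ⟩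
  b * 1ℚ                     ≡⟨ cong (b *_) (sym ΣP≡1) ⟩
  b * sumℚ n P               ≡⟨ sym (sum-*ˡ n b P) ⟩
  sumℚ n (λ i → b * P i)     ≡⟨ sum-cong n (λ i → *-comm b (P i)) ⟩
  sumℚ n (λ i → P i * b)     ≤⟨ sum-mono n (λ i → *-monoˡ-≤-nonNeg (P i) {{nonNegative (P≥0 i)}} (b≤f i)) ⟩
  sumℚ n (λ i → P i * f i)   ∎
  where open ≤-Reasoning

δ : ∀ {n} → Fin n → ℚ → Fin n → ℚ
δ a x l = if does (l ≟ a) then x else 0ℚ

δ-same : ∀ {n} (a : Fin n) x → δ a x a ≡ x
δ-same a x with a ≟ a
... | yes _   = refl
... | no a≢a = contradiction refl a≢a

δ-other : ∀ {n} (a l : Fin n) x → l ≢ a → δ a x l ≡ 0ℚ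
δ-other a l x l≢a with l ≟ a
... | yes l≡a = contradiction l≡a l≢a
... | no _    = refl

sum-δ : ∀ n (a : Fin n) x (f : Fin n → ℚ) → sumℚ n (λ l → f l * δ a x l) ≡ f a * x
sum-δ (suc n) zero    x f = begin
  f zero * x + sumℚ n (λ i → f (suc i) * 0ℚ)  ≡⟨ cong (f zero * x +_) (trans (sum-cong n (λ i → *-zeroʳ (f (suc i)))) (sum-zero n)) ⟩
  f zero * x + 0ℚ                             ≡⟨ +-identityʳ _ ⟩
  f zero * x                                  ∎
  where open ≡-Reasoning
sum-δ (suc n) (suc a) x f = begin
  f zero * 0ℚ + sumℚ n (λ i → f (suc i) * δ a x i)  ≡⟨ cong (_+ sumℚ n (λ i → f (suc i) * δ a x i)) (*-zeroʳ (f zero)) ⟩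
  0ℚ + sumℚ n (λ i → f (suc i) * δ a x i)           ≡⟨ +-identityˡ _ ⟩
  sumℚ n (λ i → f (suc i) * δ a x i)                ≡⟨ sum-δ n a x (λ i → f (suc i)) ⟩
  f (suc a) * x                                     ∎
  where open ≡-Reasoning

-- Dirac weights and the failure of the convex Ramsey condition

dirac : ∀ {m} → Fin m → Fin m → Fin m → ℚ
dirac a b l = δ a 1ℚ l + δ b (- 1ℚ) l

dirac-isDirac : ∀ {m} (a b : Fin m) → a ≢ b → IsDiracWeight (dirac a b)
dirac-isDirac a b a≢b =
  a , b ,
  trans (cong₂ _+_ (δ-same a 1ℚ) (δ-other b a _ a≢b)) (+-identityʳ 1ℚ) ,
  trans (cong₂ _+_ (δ-other a b _ (a≢b ∘ sym)) (δ-same b _)) (+-identityˡ _) ,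
  λ c c≢a c≢b → cong₂ _+_ (δ-other a c _ c≢a) (δ-other b c _ c≢b)

dirac-pairing : ∀ m (a b : Fin m) (f : Fin m → ℚ) →
  sumℚ m (λ l → f l * dirac a b l) ≡ f a - f b
dirac-pairing m a b f = begin
  sumℚ m (λ l → f l * dirac a b l)                                 ≡⟨ sum-cong m (λ l → *-distribˡ-+ (f l) _ _) ⟩
  sumℚ m (λ l → f l * δ a 1ℚ l + f l * δ b (- 1ℚ) l)               ≡⟨ sum-+ m _ _ ⟩
  sumℚ m (λ l → f l * δ a 1ℚ l) + sumℚ m (λ l → f l * δ b (- 1ℚ) l) ≡⟨ cong₂ _+_ (sum-δ m a 1ℚ f) (sum-δ m b (- 1ℚ) f) ⟩
  f a * 1ℚ + f b * (- 1ℚ)                                          ≡⟨ simplify (f a) (f b) ⟩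
  f a - f b                                                        ∎
  where
  open ≡-Reasoning
  open +-*-Solver
  simplify : ∀ x y → x * 1ℚ + y * (- 1ℚ) ≡ x - y
  simplify = solve 2 (λ x y → x :* con 1ℚ :+ y :* (:- con 1ℚ) := x :- y) refl

-- Suppose Y has M pairs of distinct columns (a i, b i)
-- such that in every row the entries at the a-columns exceed those at the
-- b-columns by at least β in total, and β > M/2.  Then every probability
-- vector P gives some Dirac weight dirac (a i) (b i) value above 1/2: the
-- sum of these M values is a P-average of row totals, hence at least β.
notConvexRamsey : ∀ {n m} (Y : BinMatrix n m) (M : ℕ) (a b : Fin M → Fin m) →
  (∀ i → a i ≢ b i) → (β : ℚ) →
  (∀ j → β ≤ sumℚ M (λ i → bitℚ (Y j (a i)) - bitℚ (Y j (b i)))) →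
  ¬ (β ≤ sumℚ M (λ _ → ½)) → ¬ ConvexRamsey Y
notConvexRamsey {n} {m} Y M a b a≢b β rowTotal β>M/2 (P , isProb , P·Y·W≤½) = β>M/2 (begin
  β                                                          ≤⟨ convex-lower n P rowDiff β isProb rowTotal ⟩
  sumℚ n (λ j → P j * rowDiff j)                             ≡⟨ sum-cong n (λ j → sym (sum-*ˡ M (P j) (diff j))) ⟩
  sumℚ n (λ j → sumℚ M (λ i → P j * diff j i))               ≡⟨ sym (sum-swap M n (λ i j → P j * diff j i)) ⟩
  sumℚ M (λ i → sumℚ n (λ j → P j * diff j i))               ≡⟨ sum-cong M (λ i → sum-cong n (λ j → cong (P j *_) (sym (dirac-pairing m (a i) (b i) (bit j))))) ⟩
  sumℚ M (λ i → tripleProduct P Y (dirac (a i) (b i)))       ≤⟨ sum-mono M (λ i → P·Y·W≤½ _ (dirac-isDirac (a i) (b i) (a≢b i))) ⟩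
  sumℚ M (λ _ → ½)                                           ∎)
  where
  open ≤-Reasoning
  bit : Fin n → Fin m → ℚ
  bit j l = bitℚ (Y j l)
  diff : Fin n → Fin M → ℚ
  diff j i = bit j (a i) - bit j (b i)
  rowDiff : Fin n → ℚ
  rowDiff j = sumℚ M (diff j)

-- Separating binary codes by few coordinates

-- Elements of Fin (2 ^ t) code the binary words Fin t → Fin 2; the
-- restriction of the word coded by c to the coordinates D, itself coded.
project : ∀ {t k} → (Fin k → Fin t) → Fin (2 ℕ.^ t) → Fin (2 ℕ.^ k)
project D c = funToFin (finToFun c ∘ D)

funToFin-cong : ∀ {m n} {f g : Fin m → Fin n} → (∀ e → f e ≡ g e) → funToFin f ≡ funToFin g
funToFin-cong {zero}  f≗g = refl
funToFin-cong {suc m} f≗g = cong₂ combine (f≗g zero) (funToFin-cong (f≗g ∘ suc))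

codes-differ : ∀ {t} {c c′ : Fin (2 ℕ.^ t)} → c ≢ c′ → ∃ λ e → finToFun c e ≢ finToFun c′ e
codes-differ {t} {c} {c′} c≢c′ =
  ¬∀⟶∃¬ t _ (λ e → finToFun c e ≟ finToFun c′ e) λ same →
    c≢c′ (trans (sym (funToFin-finToFin {t} {2} c)) (trans (funToFin-cong same) (funToFin-finToFin {t} {2} c′)))

project-∷-injective : ∀ {t k} (e : Fin t) (D : Fin k → Fin t) {c c′ : Fin (2 ℕ.^ t)} →
  project (e ∷ D) c ≡ project (e ∷ D) c′ →
  finToFun c e ≡ finToFun c′ e × project D c ≡ project D c′
project-∷-injective e D {c} {c′} = combine-injective (finToFun c e) (project D c) (finToFun c′ e) (project D c′)

Separates : ∀ {t k} → (Fin k → Fin t) → (Fin k → Fin (2 ℕ.^ t)) → Set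
Separates D u = ∀ i i′ → project D (u i) ≡ project D (u i′) → u i ≡ u i′

-- Induction: separate the last k codes by D′; if the first code
-- collides on D′ with a different one, add a coordinate telling them apart.
separate : ∀ {t} → Fin t → ∀ k (u : Fin k → Fin (2 ℕ.^ t)) →
  ∃ λ (D : Fin k → Fin t) → Separates D u
separate e₀ zero    u = (λ ()) , λ ()
separate {t} e₀ (suc k) u with separate e₀ k (u ∘ suc)
... | D′ , sep′ with any? (λ j → (project D′ (u (suc j)) ≟ project D′ (u zero)) ×-dec ¬? (u (suc j) ≟ u zero))
... | yes (j , collide , u-j≢u-0) = (e ∷ D′) , sep
  where
  e : Fin t
  e = proj₁ (codes-differ {t} u-j≢u-0)
  e-differs : finToFun (u (suc j)) e ≢ finToFun (u zero) e
  e-differs = proj₂ (codes-differ {t} u-j≢u-0)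
  sep : Separates {t} (e ∷ D′) u
  sep zero    zero     _  = refl
  sep (suc i) (suc i′) eq = sep′ i i′ (proj₂ (project-∷-injective _ D′ eq))
  sep zero    (suc i′) eq with project-∷-injective e D′ eq
  ... | e-eq , D′-eq = ⊥-elim (e-differs (subst (λ c → finToFun c e ≡ finToFun (u zero) e) u-i′≡u-j (sym e-eq)))
    where
    u-i′≡u-j : u (suc i′) ≡ u (suc j)
    u-i′≡u-j = sep′ i′ j (trans (sym D′-eq) (sym collide))
  sep (suc i) zero     eq = sym (sep zero (suc i) (sym eq))
... | no no-collision = (e₀ ∷ D′) , sep
  where
  sep : Separates {t} (e₀ ∷ D′) u
  sep zero    zero     _  = refl
  sep (suc i) (suc i′) eq = sep′ i i′ (proj₂ (project-∷-injective _ D′ eq))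
  sep zero    (suc i′) eq with u (suc i′) ≟ u zero
  ... | yes u-i′≡u-0 = sym u-i′≡u-0
  ... | no  u-i′≢u-0 = ⊥-elim (no-collision (i′ , sym (proj₂ (project-∷-injective e₀ D′ eq)) , u-i′≢u-0))
  sep (suc i) zero     eq = sym (sep zero (suc i) (sym eq))

module Table {K : Set} (_==_ : DecidableEquality K) where

  lookup : ∀ {k} → (Fin k → K) → (Fin k → Bool) → K → Bool → Bool
  lookup {zero}  κ v x d = d
  lookup {suc k} κ v x d = if does (κ zero == x) then v zero else lookup (κ ∘ suc) (v ∘ suc) x d

  lookup-hit : ∀ {k} (κ : Fin k → K) v x d b → (∃ λ i → κ i ≡ x) →
    (∀ i → κ i ≡ x → v i ≡ b) → lookup κ v x d ≡ b
  lookup-hit {suc k} κ v x d b (i , κᵢ≡x) agree with κ zero == x | i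
  ... | yes κ₀≡x | _     = agree zero κ₀≡x
  ... | no  κ₀≢x | zero  = ⊥-elim (κ₀≢x κᵢ≡x)
  ... | no  _    | suc i = lookup-hit (κ ∘ suc) (v ∘ suc) x d b (i , κᵢ≡x) (agree ∘ suc)

  lookup-cong : ∀ {k} {κ κ′ : Fin k → K} {v v′ : Fin k → Bool} x d →
    (∀ i → κ i ≡ κ′ i) → (∀ i → v i ≡ v′ i) → lookup κ v x d ≡ lookup κ′ v′ x d
  lookup-cong {zero}  x d κ≗κ′ v≗v′ = refl
  lookup-cong {suc k} x d κ≗κ′ v≗v′
    rewrite κ≗κ′ zero | v≗v′ zero | lookup-cong x d (κ≗κ′ ∘ suc) (v≗v′ ∘ suc) = refl

-- Tables deviating little from a default pattern

_•_ : ℕ → ℚ → ℚ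
n • x = sumℚ n (λ _ → x)

two : ℚ
two = 1ℚ + 1ℚ

if-no : ∀ {A : Set} (d : Dec A) {x y : Bool} → ¬ A → (if does d then x else y) ≡ y
if-no (yes a) ¬a = ⊥-elim (¬a a)
if-no (no _)  ¬a = refl

bitDiff : Bool → Bool → ℚ
bitDiff x y = bitℚ x - bitℚ y

bitDiff≤1 : ∀ x y → bitDiff x y ≤ 1ℚ
bitDiff≤1 true  true  = ≤ᵇ⇒≤ _
bitDiff≤1 true  false = ≤ᵇ⇒≤ _
bitDiff≤1 false true  = ≤ᵇ⇒≤ _
bitDiff≤1 false false = ≤ᵇ⇒≤ _

-1≤bitDiff : ∀ x y → - 1ℚ ≤ bitDiff x y
-1≤bitDiff true  true  = ≤ᵇ⇒≤ _
-1≤bitDiff true  false = ≤ᵇ⇒≤ _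
-1≤bitDiff false true  = ≤ᵇ⇒≤ _
-1≤bitDiff false false = ≤ᵇ⇒≤ _

-- Columns of M pairs: inj₁ m is the column aₘ, inj₂ m the column bₘ.
PairCol : ℕ → Set
PairCol M = Fin M ⊎ Fin M

pairIndex : ∀ {M} → PairCol M → Fin M
pairIndex (inj₁ m) = m
pairIndex (inj₂ m) = m

Key : ℕ → ℕ → Set
Key c M = Fin c ⊎ PairCol M

_≟ᴷ_ : ∀ {c M} → DecidableEquality (Key c M)
_≟ᴷ_ = ≡-dec _≟_ (≡-dec _≟_ _≟_)

module _ {c M : ℕ} where
  open Table (_≟ᴷ_ {c} {M})

  balance : ∀ {k} → (Fin k → Key c M) → (Fin k → Bool) → Fin M → ℚ
  balance κ v m = bitDiff (lookup κ v (inj₂ (inj₁ m)) true) (lookup κ v (inj₂ (inj₂ m)) false)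

  -- How much an entry with key q can lower the balance of pair m.
  loss : Key c M → Fin M → ℚ
  loss (inj₁ _) m = 0ℚ
  loss (inj₂ p) m = δ (pairIndex p) two m

  total-loss : ∀ q → sumℚ M (loss q) ≤ two
  total-loss (inj₁ _) = ≤-trans (≤-reflexive (sum-zero M)) (≤ᵇ⇒≤ _)
  total-loss (inj₂ p) = ≤-reflexive (begin
    sumℚ M (δ (pairIndex p) two)                     ≡⟨ sum-cong M (λ m → sym (*-identityˡ _)) ⟩
    sumℚ M (λ m → 1ℚ * δ (pairIndex p) two m)        ≡⟨ sum-δ M (pairIndex p) two (λ _ → 1ℚ) ⟩
    1ℚ * two                                         ≡⟨ *-identityˡ two ⟩
    two                                              ∎)
    where open ≡-Reasoning

  bitDiff-drop : ∀ x y x′ y′ → bitDiff x y - two ≤ bitDiff x′ y′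
  bitDiff-drop x y x′ y′ = ≤-trans (+-monoˡ-≤ (- two) (bitDiff≤1 x y)) (-1≤bitDiff x′ y′)

  balance-step : ∀ {k} q b (κ : Fin k → Key c M) v m →
    balance κ v m - loss q m ≤ balance (q ∷ κ) (b ∷ v) m
  balance-step (inj₁ _) b κ v m = ≤-reflexive (+-identityʳ _)
  balance-step (inj₂ p) b κ v m with m ≟ pairIndex p
  ... | yes _  = bitDiff-drop (old (inj₁ m) true) (old (inj₂ m) false) (new (inj₁ m) true) (new (inj₂ m) false)
    where
    old new : PairCol M → Bool → Bool
    old p′ d = lookup κ v (inj₂ p′) d
    new p′ d = lookup (inj₂ p ∷ κ) (b ∷ v) (inj₂ p′) d
  ... | no m≢p = ≤-reflexive (trans (+-identityʳ _) (sym (cong₂ bitDiff (skip (inj₁ m) refl) (skip (inj₂ m) refl))))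
    where
    skip : ∀ {x y : Bool} (p′ : PairCol M) → pairIndex p′ ≡ m →
      (if does (≡-dec _≟_ _≟_ p p′) then x else y) ≡ y
    skip p′ p′∈m = if-no (≡-dec _≟_ _≟_ p p′) λ p≡p′ → m≢p (trans (sym p′∈m) (cong pairIndex (sym p≡p′)))

  balance-bound : ∀ {k} (κ : Fin k → Key c M) v → M • 1ℚ - k • two ≤ sumℚ M (balance κ v)
  balance-bound {zero}  κ v = ≤-reflexive (trans (+-identityʳ _) (sum-cong M (λ m → refl)))
  balance-bound {suc k} κ v = begin
    M • 1ℚ - (two + k • two)                                     ≡⟨ regroup (M • 1ℚ) (k • two) ⟩
    (M • 1ℚ - k • two) - two                                     ≤⟨ +-monoˡ-≤ (- two) (balance-bound (κ ∘ suc) (v ∘ suc)) ⟩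
    sumℚ M tail - two                                            ≤⟨ +-monoʳ-≤ (sumℚ M tail) (neg-antimono-≤ (total-loss (κ zero))) ⟩
    sumℚ M tail - sumℚ M (loss (κ zero))                         ≡⟨ sym (sum-diff M tail (loss (κ zero))) ⟩
    sumℚ M (λ m → tail m - loss (κ zero) m)                      ≤⟨ sum-mono M (balance-step (κ zero) (v zero) (κ ∘ suc) (v ∘ suc)) ⟩
    sumℚ M (balance κ v)                                         ∎
    where
    open ≤-Reasoning
    open +-*-Solver
    tail : Fin M → ℚ
    tail = balance (κ ∘ suc) (v ∘ suc)
    regroup : ∀ x y → x - (two + y) ≡ (x - y) - two
    regroup = solve 2 (λ x y → x :- (con two :+ y) := (x :- y) :- con two) refl

-- The numbers of the construction

-- The number M = 4k + 1 of column pairs: one more than 4k, so that a row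
-- total of at least M - 2k exceeds M/2.
pairCount : ℕ → ℕ
pairCount zero    = 1
pairCount (suc k) = 4 ℕ.+ pairCount k

k<pairCount : ∀ k → k ℕ.< pairCount k
k<pairCount zero    = s≤s z≤n
k<pairCount (suc k) = ℕ.≤-trans (s≤s (k<pairCount k)) (ℕ.m≤n+m _ 3)

surplus : ∀ k → pairCount k • 1ℚ - k • two ≡ pairCount k • ½ + ½
surplus zero    = refl
surplus (suc k) = begin
  (1ℚ + (1ℚ + (1ℚ + (1ℚ + A)))) - (two + B)    ≡⟨ regroup A B ⟩
  (A - B) + two                                 ≡⟨ cong (_+ two) (surplus k) ⟩
  (C + ½) + two                                 ≡⟨ spread C ⟩
  (½ + (½ + (½ + (½ + C)))) + ½                 ∎
  where
  open ≡-Reasoning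
  open +-*-Solver
  A B C : ℚ
  A = pairCount k • 1ℚ
  B = k • two
  C = pairCount k • ½
  regroup : ∀ a b → (1ℚ + (1ℚ + (1ℚ + (1ℚ + a)))) - (two + b) ≡ (a - b) + two
  regroup = solve 2 (λ a b → (con 1ℚ :+ (con 1ℚ :+ (con 1ℚ :+ (con 1ℚ :+ a)))) :- (con two :+ b)
                             := (a :- b) :+ con two) refl
  spread : ∀ c → (c + ½) + two ≡ (½ + (½ + (½ + (½ + c)))) + ½
  spread = solve 1 (λ c → (c :+ con ½) :+ con two := (con ½ :+ (con ½ :+ (con ½ :+ (con ½ :+ c)))) :+ con ½) refl

surplus-too-big : ∀ k → ¬ (pairCount k • 1ℚ - k • two ≤ pairCount k • ½)
surplus-too-big k bound = <-irrefl refl (≤-<-trans (subst (_≤ C) (surplus k) bound) C<C+½)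
  where
  C : ℚ
  C = pairCount k • ½
  C<C+½ : C < C + ½
  C<C+½ = subst (_< C + ½) (+-identityʳ C) (+-monoʳ-< C {0ℚ} {½} (positive⁻¹ ½))

n≤2^n : ∀ n → n ℕ.≤ 2 ℕ.^ n
n≤2^n zero    = z≤n
n≤2^n (suc n) = ℕ.+-mono-≤ (ℕ.m^n>0 2 n) (ℕ.≤-trans (n≤2^n n) (ℕ.m≤m+n _ 0))

square≤2^ : ∀ w → (6 ℕ.+ w) ℕ.* (5 ℕ.+ w) ℕ.≤ 2 ℕ.^ (5 ℕ.+ w)
square≤2^ zero    = ℕ.≤ᵇ⇒≤ 30 32 _
square≤2^ (suc w) = begin
  (7 ℕ.+ w) ℕ.* (6 ℕ.+ w)         ≤⟨ ℕ.*-monoˡ-≤ (6 ℕ.+ w) 7+w≤2[5+w] ⟩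
  (2 ℕ.* (5 ℕ.+ w)) ℕ.* (6 ℕ.+ w) ≡⟨ trans (ℕ.*-assoc 2 (5 ℕ.+ w) (6 ℕ.+ w)) (cong (2 ℕ.*_) (ℕ.*-comm (5 ℕ.+ w) (6 ℕ.+ w))) ⟩
  2 ℕ.* ((6 ℕ.+ w) ℕ.* (5 ℕ.+ w)) ≤⟨ ℕ.*-monoʳ-≤ 2 (square≤2^ w) ⟩
  2 ℕ.^ (6 ℕ.+ w)                 ∎
  where
  open ℕ.≤-Reasoning
  7+w≤2[5+w] : 7 ℕ.+ w ℕ.≤ 2 ℕ.* (5 ℕ.+ w)
  7+w≤2[5+w] = subst (7 ℕ.+ w ℕ.≤_) (cong ((5 ℕ.+ w) ℕ.+_) (sym (ℕ.+-identityʳ (5 ℕ.+ w))))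
                      (ℕ.+-monoˡ-≤ (5 ℕ.+ w) {2} {5 ℕ.+ w} (s≤s (s≤s z≤n)))

polynomial≤2^ : ∀ a B → ∃ λ t → 0 ℕ.< t × (t ℕ.* B) ℕ.^ a ℕ.≤ 2 ℕ.^ t
polynomial≤2^ a B = t , ℕ.m^n>0 2 z , (begin
  (t ℕ.* B) ℕ.^ a        ≤⟨ ℕ.^-monoˡ-≤ a (ℕ.*-monoʳ-≤ t B≤t) ⟩
  (t ℕ.* t) ℕ.^ a        ≡⟨ cong (ℕ._^ a) (sym (ℕ.^-distribˡ-+-* 2 z z)) ⟩
  (2 ℕ.^ (z ℕ.+ z)) ℕ.^ a ≡⟨ ℕ.^-*-assoc 2 (z ℕ.+ z) a ⟩
  2 ℕ.^ ((z ℕ.+ z) ℕ.* a) ≤⟨ ℕ.^-monoʳ-≤ 2 exponent≤ ⟩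
  2 ℕ.^ t                ∎)
  where
  open ℕ.≤-Reasoning
  w z t : ℕ
  w = (a ℕ.+ a) ℕ.+ B
  z = 5 ℕ.+ w
  t = 2 ℕ.^ z
  B≤t : B ℕ.≤ t
  B≤t = ℕ.≤-trans (ℕ.m≤n+m B (a ℕ.+ a)) (ℕ.≤-trans (ℕ.m≤n+m w 5) (n≤2^n z))
  exponent≤ : (z ℕ.+ z) ℕ.* a ℕ.≤ t
  exponent≤ = begin
    (z ℕ.+ z) ℕ.* a ≡⟨ trans (ℕ.*-distribʳ-+ a z z) (sym (ℕ.*-distribˡ-+ z a a)) ⟩
    z ℕ.* (a ℕ.+ a) ≤⟨ ℕ.*-monoʳ-≤ z (ℕ.≤-trans (ℕ.m≤m+n (a ℕ.+ a) B) (ℕ.m≤n+m w 5)) ⟩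
    z ℕ.* z         ≤⟨ ℕ.m≤n+m (z ℕ.* z) z ⟩
    suc z ℕ.* z     ≤⟨ square≤2^ w ⟩
    t               ∎

decode⊎ : ∀ a b → Fin (a ℕ.+ (b ℕ.+ b)) → Fin a ⊎ (Fin b ⊎ Fin b)
decode⊎ a b i = Sum.map₂ (splitAt b) (splitAt a i)

encode⊎ : ∀ a b → Fin a ⊎ (Fin b ⊎ Fin b) → Fin (a ℕ.+ (b ℕ.+ b))
encode⊎ a b x = join a (b ℕ.+ b) (Sum.map₂ (join b b) x)

decode-encode⊎ : ∀ a b x → decode⊎ a b (encode⊎ a b x) ≡ x
decode-encode⊎ a b (inj₁ i) = cong (Sum.map₂ (splitAt b)) (splitAt-join a (b ℕ.+ b) (inj₁ i))
decode-encode⊎ a b (inj₂ p) =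
  trans (cong (Sum.map₂ (splitAt b)) (splitAt-join a (b ℕ.+ b) (inj₂ (join b b p))))
        (cong inj₂ (splitAt-join b b p))

decode⊎-injective : ∀ a b {i j} → decode⊎ a b i ≡ decode⊎ a b j → i ≡ j
decode⊎-injective a b {i} {j} eq = trans (sym (encode-decode i)) (trans (cong (encode⊎ a b) eq) (encode-decode j))
  where
  encode-decode : ∀ i → encode⊎ a b (decode⊎ a b i) ≡ i
  encode-decode i with splitAt a i in split
  ... | inj₁ _ = trans (cong (join a (b ℕ.+ b)) (sym split)) (join-splitAt a (b ℕ.+ b) i)
  ... | inj₂ r = trans (cong (λ r′ → join a (b ℕ.+ b) (inj₂ r′)) (join-splitAt b b r))
                       (trans (cong (join a (b ℕ.+ b)) (sym split)) (join-splitAt a (b ℕ.+ b) i))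

toBool : Fin 2 → Bool
toBool zero    = false
toBool (suc _) = true

fromBool : Bool → Fin 2
fromBool false = zero
fromBool true  = suc zero

toBool-fromBool : ∀ b → toBool (fromBool b) ≡ b
toBool-fromBool false = refl
toBool-fromBool true  = refl

extend : ∀ {A : Set} {R n} → R ℕ.≤ n → A → (Fin R → A) → Fin n → A
extend {R = R} R≤n a₀ f j with toℕ j ℕ.<? R
... | yes j<R = f (fromℕ< j<R)
... | no  _   = a₀

extend-inject≤ : ∀ {A : Set} {R n} (R≤n : R ℕ.≤ n) a₀ (f : Fin R → A) r →
  extend R≤n a₀ f (inject≤ r R≤n) ≡ f r
extend-inject≤ {R = R} R≤n a₀ f r with toℕ (inject≤ r R≤n) ℕ.<? R
... | yes j<R = cong f (toℕ-injective (trans (toℕ-fromℕ< j<R) (toℕ-inject≤ r R≤n)))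
... | no  j≮R = ⊥-elim (j≮R (subst (ℕ._< R) (sym (toℕ-inject≤ r R≤n)) (toℕ<n r)))

increasing-injective : ∀ {k m} (l : Fin k → Fin m) → (∀ i i′ → i <ᶠ i′ → l i <ᶠ l i′) →
  ∀ {i i′} → l i ≡ l i′ → i ≡ i′
increasing-injective l increasing {i} {i′} eq with Finₚ.<-cmp i i′
... | tri< i<i′ _ _ = ⊥-elim (Finₚ.<-irrefl eq (increasing i i′ i<i′))
... | tri≈ _ i≡i′ _ = i≡i′
... | tri> _ _ i′<i = ⊥-elim (Finₚ.<-irrefl (sym eq) (increasing i′ i i′<i))

-- The construction

zeroWord : ∀ {m} → Fin (2 ℕ.^ m)
zeroWord {m} = funToFin {m} {2} (λ _ → zero)

module Construction (k : ℕ) where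

  M : ℕ
  M = pairCount k

  Entry : ℕ → Set
  Entry t = Fin t × Key (2 ℕ.^ k) M × Bool

  K : ℕ
  K = 2 ℕ.^ k ℕ.+ (M ℕ.+ M)

  B : ℕ
  B = K ℕ.* 2

  decodePayload : Fin B → Key (2 ℕ.^ k) M × Bool
  decodePayload r = decode⊎ (2 ℕ.^ k) M (proj₁ (remQuot {K} 2 r)) , toBool (proj₂ (remQuot {K} 2 r))

  encodePayload : Key (2 ℕ.^ k) M × Bool → Fin B
  encodePayload (q , b) = combine (encode⊎ (2 ℕ.^ k) M q) (fromBool b)

  decodeEntry : ∀ {t} → Fin (t ℕ.* B) → Entry t
  decodeEntry {t} i = proj₁ (remQuot {t} B i) , decodePayload (proj₂ (remQuot {t} B i))

  encodeEntry : ∀ {t} → Entry t → Fin (t ℕ.* B)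
  encodeEntry (e , qb) = combine e (encodePayload qb)

  decode-encodePayload : ∀ qb → decodePayload (encodePayload qb) ≡ qb
  decode-encodePayload (q , b) =
    cong₂ _,_ (trans (cong (decode⊎ (2 ℕ.^ k) M ∘ proj₁) split) (decode-encode⊎ (2 ℕ.^ k) M q))
              (trans (cong (toBool ∘ proj₂) split) (toBool-fromBool b))
    where
    split : remQuot {K} 2 (encodePayload (q , b)) ≡ (encode⊎ (2 ℕ.^ k) M q , fromBool b)
    split = remQuot-combine {K} {2} (encode⊎ (2 ℕ.^ k) M q) (fromBool b)

  decode-encodeEntry : ∀ {t} (x : Entry t) → decodeEntry (encodeEntry x) ≡ x
  decode-encodeEntry {t} (e , qb) =
    cong₂ _,_ (cong proj₁ split) (trans (cong (decodePayload ∘ proj₂) split) (decode-encodePayload qb))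
    where
    split : remQuot {t} B (encodeEntry (e , qb)) ≡ (e , encodePayload qb)
    split = remQuot-combine {t} {B} e (encodePayload qb)

  -- The matrix, for a word length t large enough that the (t B)^k possible
  -- rows fit into the 2^t + 2M available indices.
  module Matrix (t : ℕ) (0<t : 0 ℕ.< t) (growth : (t ℕ.* B) ℕ.^ k ℕ.≤ 2 ℕ.^ t) where

    N n : ℕ
    N = 2 ℕ.^ t
    n = N ℕ.+ (M ℕ.+ M)

    -- Columns: the N binary words of length t, and the 2M paired columns.
    Col : Set
    Col = Key N M

    decodeCol : Fin n → Col
    decodeCol = decode⊎ N M

    Row : Set
    Row = Fin k → Entry t

    coords : Row → Fin k → Fin t
    coords ρ i = proj₁ (ρ i)

    keys : Row → Fin k → Key (2 ℕ.^ k) M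
    keys ρ i = proj₁ (proj₂ (ρ i))

    vals : Row → Fin k → Bool
    vals ρ i = proj₂ (proj₂ (ρ i))

    keyOf : (Fin k → Fin t) → Col → Key (2 ℕ.^ k) M
    keyOf D (inj₁ c) = inj₁ (project D c)
    keyOf D (inj₂ p) = inj₂ p

    default : Col → Bool
    default (inj₂ (inj₁ _)) = true
    default _               = false

    open Table (_≟ᴷ_ {2 ℕ.^ k} {M})

    entry : Row → Col → Bool
    entry ρ x = lookup (keys ρ) (vals ρ) (keyOf (coords ρ) x) (default x)

    R : ℕ
    R = (t ℕ.* B) ℕ.^ k

    R≤n : R ℕ.≤ n
    R≤n = ℕ.≤-trans growth (ℕ.m≤m+n N (M ℕ.+ M))

    decodeRow : Fin R → Row
    decodeRow r i = decodeEntry (finToFun r i)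

    encodeRow : Row → Fin R
    encodeRow ρ = funToFin (encodeEntry ∘ ρ)

    decode-encodeRow : ∀ ρ i → decodeRow (encodeRow ρ) i ≡ ρ i
    decode-encodeRow ρ i = trans (cong decodeEntry (finToFun-funToFin (encodeEntry ∘ ρ) i)) (decode-encodeEntry (ρ i))

    e₀ : Fin t
    e₀ = fromℕ< 0<t

    blankRow : Row
    blankRow _ = e₀ , inj₁ (zeroWord {k}) , false

    rowOf : Fin n → Row
    rowOf = extend R≤n blankRow decodeRow

    X : BinMatrix n n
    X j l = entry (rowOf j) (decodeCol l)

    pairA pairB : Fin M → Fin n
    pairA m = encode⊎ N M (inj₂ (inj₁ m))
    pairB m = encode⊎ N M (inj₂ (inj₂ m))

    pairs-distinct : ∀ m → pairA m ≢ pairB m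
    pairs-distinct m a≡b with trans (sym (decode-encode⊎ N M (inj₂ (inj₁ m))))
                                     (trans (cong decodeCol a≡b) (decode-encode⊎ N M (inj₂ (inj₂ m))))
    ... | ()

    row-balance : ∀ j → M • 1ℚ - k • two ≤ sumℚ M (λ m → bitℚ (X j (pairA m)) - bitℚ (X j (pairB m)))
    row-balance j = ≤-trans (balance-bound (keys ρ) (vals ρ)) (≤-reflexive (sum-cong M λ m →
      sym (cong₂ bitDiff (cong (entry ρ) (decode-encode⊎ N M _)) (cong (entry ρ) (decode-encode⊎ N M _)))))
      where
      ρ : Row
      ρ = rowOf j

    X-notConvexRamsey : ¬ ConvexRamsey X
    X-notConvexRamsey = notConvexRamsey X M pairA pairB pairs-distinct _ row-balance (surplus-too-big k)

    -- The word of a column, with the paired columns sent to the zero word.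
    word : Col → Fin N
    word (inj₁ c) = c
    word (inj₂ _) = zeroWord {t}

    keyOf-separates : ∀ D x y → (project D (word x) ≡ project D (word y) → word x ≡ word y) →
      keyOf D x ≡ keyOf D y → x ≡ y
    keyOf-separates D (inj₁ c) (inj₁ c′) sep eq = cong inj₁ (sep (inj₁-injective eq))
    keyOf-separates D (inj₂ p) (inj₂ p′) sep eq = cong inj₂ (inj₂-injective eq)
    keyOf-separates D (inj₁ _) (inj₂ _) sep ()
    keyOf-separates D (inj₂ _) (inj₁ _) sep ()

    -- Entries depend only on the entries of the table (decoding a row only
    -- reproduces it pointwise).
    entry-cong : ∀ {ρ ρ′} → (∀ i → ρ i ≡ ρ′ i) → ∀ x → entry ρ x ≡ entry ρ′ x
    entry-cong {ρ} {ρ′} ρ≗ρ′ x =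
      trans (cong (λ κ → lookup (keys ρ) (vals ρ) κ (default x)) (keyOf-cong x))
            (lookup-cong _ _ (λ i → cong (proj₁ ∘ proj₂) (ρ≗ρ′ i)) (λ i → cong (proj₂ ∘ proj₂) (ρ≗ρ′ i)))
      where
      keyOf-cong : ∀ x → keyOf (coords ρ) x ≡ keyOf (coords ρ′) x
      keyOf-cong (inj₁ c) = cong inj₁ (funToFin-cong (λ e → cong (finToFun c ∘ proj₁) (ρ≗ρ′ e)))
      keyOf-cong (inj₂ p) = refl

    rowOf-encode : ∀ ρ i → rowOf (inject≤ (encodeRow ρ) R≤n) i ≡ ρ i
    rowOf-encode ρ i = trans (cong (λ ρ′ → ρ′ i) (extend-inject≤ R≤n blankRow decodeRow (encodeRow ρ))) (decode-encodeRow ρ i)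

    exhibitingRow : (Fin k → Fin t) → (Fin k → Col) → (Fin k → Bool) → Row
    exhibitingRow D cols σ i = D i , keyOf D (cols i) , σ i

    exhibitingRow-exhibits : ∀ D cols σ → Separates D (word ∘ cols) →
      (∀ {i i′} → cols i ≡ cols i′ → i ≡ i′) → ∀ i → entry (exhibitingRow D cols σ) (cols i) ≡ σ i
    exhibitingRow-exhibits D cols σ sep cols-injective i =
      lookup-hit _ _ _ _ (σ i) (i , refl)
        (λ i′ eq → cong σ (cols-injective (keyOf-separates D (cols i′) (cols i) (sep i′ i) eq)))

    exhibit : (σ : Fin k → Bool) (l : Fin k → Fin n) → (∀ {i i′} → l i ≡ l i′ → i ≡ i′) →
      ∃ λ j → ∀ i → X j (l i) ≡ σ i
    exhibit σ l l-injective = j , λ i →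
      trans (entry-cong (rowOf-encode ρ) (cols i)) (exhibitingRow-exhibits D cols σ sep cols-injective i)
      where
      cols : Fin k → Col
      cols = decodeCol ∘ l
      cols-injective : ∀ {i i′} → cols i ≡ cols i′ → i ≡ i′
      cols-injective = l-injective ∘ decode⊎-injective N M
      separation : ∃ λ (D : Fin k → Fin t) → Separates D (word ∘ cols)
      separation = separate e₀ k (word ∘ cols)
      D : Fin k → Fin t
      D = proj₁ separation
      sep : Separates D (word ∘ cols)
      sep = proj₂ separation
      ρ : Row
      ρ = exhibitingRow D cols σ
      j : Fin n
      j = inject≤ (encodeRow ρ) R≤n

    k<n : k ℕ.< n
    k<n = ℕ.≤-trans (k<pairCount k) (ℕ.≤-trans (ℕ.m≤m+n M M) (ℕ.m≤n+m (M ℕ.+ M) N))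

    X-exhibits : ConfigExhibition k X
    X-exhibits = ℕ.<⇒≤ k<n , λ σ l increasing → exhibit σ l (increasing-injective l increasing)

mainTheorem1 : (k : ℕ) → 1 ℕ.≤ k →
    ∃ λ (n : ℕ) → (k ℕ.< n) × (∃ λ (X : BinMatrix n n) → ConfigExhibition k X × ¬ ConvexRamsey X)
mainTheorem1 k _ with polynomial≤2^ k (Construction.B k)
... | t , 0<t , growth = n , k<n , X , X-exhibits , X-notConvexRamsey
  where open Construction.Matrix k t 0<t growth
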